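{- Let $A,B,C$ be games, and let $\sigma$ be an exhaustive strategy on $A\vdash B$ and $\tau$ an exhaustive strategy on $B\vdash C$. Let $x^\sigma$ be a $+$-covered configuration of $\sigma$ and $x^\tau$ a $+$-covered configuration of $\tau$ with $\partial_\sigma(x^\sigma)=x^\sigma_A\parallel x_B$ and $\partial_\tau(x^\tau)=x_B\parallel x^\tau_C$ for the same $x_B\in\mathscr C(B)$. If $\kappa_A(x^\sigma_A)=0$ and $\kappa_C(x^\tau_C)=0$, then $\kappa_B(x_B)=0$.
   Context: Event structures: a countable set of events with a partial order $\le$ (finite down-sets) and an irreflexive symmetric conflict $\#$ satisfying $e_1\#e_2\le e_2'\Rightarrow e_1\#e_2'$; configurations are finite down-closed conflict-free sets of events ($\mathscr C(E)$); $e\rightarrow e'$ is immediate causality. An isomorphism family $\tilde E$ is a set of bijections between configurations containing identities, closed under composition and inverse, such that every symmetry has a unique restriction to any sub-configuration of its domain and some extension to any configuration containing its domain; write $\theta:x\cong_Ey$. A tcg $A$ is an event structure with isomorphism family $\tilde A$, polarity $\mathrm{pol}_A:|A|\to\{ -,+\}$ preserved by symmetries, and subfamilies $\tilde A_+,\tilde A_-$ (positive/negative symmetries) meeting only in identities, each closed within $\tilde A$ under extension by pairs of events of its own polarity. A game is a tcg with a symmetry-invariant payoff $\kappa_A:\mathscr C(A)\to\{ -1,0,+1\}$ (and a chosen canonical representative for each payoff-$0$ symmetry class). The dual $A^\perp$ reverses polarities, swaps $\tilde A_+$ and $\tilde A_-$ and negates the payoff. For games $A,B$, $A\vdash B$ has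 events $\{1\}\times|A|\uplus\{2\}\times|B|$, causality/conflict componentwise, polarity reversed on the $A$ side, configurations $x_A\parallel x_B$, symmetries $\theta_A\parallel\theta_B$, and payoff $(-\kappa_A(x_A))\wp\kappa_B(x_B)$ where $u\wp v=+1$ if $u=+1$ or $v=+1$, else $-1$ if $u=-1$ or $v=-1$, else $0$. A strategy on a game $G$ is an event structure with symmetry $(\sigma,\tilde\sigma)$ with a display map $\partial_\sigma:|\sigma|\to|G|$ such that: $\partial_\sigma(x)\in\mathscr C(G)$ for $x\in\mathscr C(\sigma)$; $\partial_\sigma$ is injective on each configuration; $\partial_\sigma\theta\in\tilde G$ for $\theta\in\tilde\sigma$; ($\sim$-receptive) if $\theta:x\cong_\sigma y$, $x\cup\{s_1\}\in\mathscr C(\sigma)$ with $s_1$ negative and $\partial_\sigma\theta\cup\{(\partial_\sigma s_1,a_2)\}\in\tilde G$, then there is a unique $s_2$ with $\theta\cup\{(s_1,s_2)\}\in\tilde\sigma$ and $\partial_\sigma s_2=a_2$; (thin) if $\theta:x\cong_\sigma y$ and $x\cup\{s_1\}\in\mathscr C(\sigma)$ with $s_1$ positive, there is a unique $s_2$ with $y\cup\{s_2\}\in\mathscr C(\sigma)$ and $\theta\cup\{(s_1,s_2)\}\in\tilde\sigma$; minimal events of $\sigma$ are negative; (courteous) if $s_1\rightarrow_\sigma s_2$ and $s_1$ is positive or $s_2$ is negative then $\partial s_1\rightarrow_G\partial s_2$; (receptive) for $x\in\mathscr C(\sigma)$ and negative $a\notin\partial x$ with $\partial x\cup\{a\}\in\mathscr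 C(G)$ there is a unique $s$ with $x\cup\{s\}\in\mathscr C(\sigma)$ and $\partial s=a$. Events of $\sigma$ have the polarity of their display. A configuration of $\sigma$ is $+$-covered if all its maximal events are positive. $\sigma$ is exhaustive if $\kappa_G(\partial_\sigma x)\ge0$ for every $+$-covered $x$. -}

module Defs where

open import Data.Nat using (ℕ)
open import Data.Product using (Σ; ∃; _×_; _,_)
open import Data.Sum using (_⊎_; inj₁; inj₂)
open import Data.Empty using (⊥)
open import Data.Unit using (⊤)
open import Data.List using (List)
open import Data.List.Membership.Propositional using (_∈_)
open import Relation.Nullary using (¬_)
open import Relation.Binary.PropositionalEquality using (_≡_)

-- Sets of events as predicates, relations (partial bijections) as binary
-- predicates.

SetOf : Set → Set₁
SetOf E = E → Set

RelOf : Set → Set → Set₁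
RelOf E F = E → F → Set

module _ {E : Set} where
  _⊆ₛ_ : SetOf E → SetOf E → Set
  x ⊆ₛ y = ∀ e → x e → y e

  _≐ₛ_ : SetOf E → SetOf E → Set
  x ≐ₛ y = (x ⊆ₛ y) × (y ⊆ₛ x)

  insert : SetOf E → E → SetOf E
  insert x e e' = x e' ⊎ e' ≡ e

  Finite : SetOf E → Set
  Finite x = Σ (List E) λ l → ∀ e → (x e → e ∈ l) × (e ∈ l → x e)

  ∃! : (E → Set) → Set
  ∃! P = Σ E P × (∀ a b → P a → P b → a ≡ b)

module _ {E F : Set} where
  _⊆ᵣ_ : RelOf E F → RelOf E F → Set
  θ ⊆ᵣ θ' = ∀ a b → θ a b → θ' a b

  _≐ᵣ_ : RelOf E F → RelOf E F → Set
  θ ≐ᵣ θ' = (θ ⊆ᵣ θ') × (θ' ⊆ᵣ θ)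

  dom : RelOf E F → SetOf E
  dom θ a = ∃ λ b → θ a b

  cod : RelOf E F → SetOf F
  cod θ b = ∃ λ a → θ a b

  inv : RelOf E F → RelOf F E
  inv θ b a = θ a b

  extendR : RelOf E F → E → F → RelOf E F
  extendR θ a b a' b' = θ a' b' ⊎ ((a' ≡ a) × (b' ≡ b))

  restrict : RelOf E F → SetOf E → RelOf E F
  restrict θ x' a b = x' a × θ a b

  IsBij : RelOf E F → Set
  IsBij θ = (∀ a b b' → θ a b → θ a b' → b ≡ b')
          × (∀ a a' b → θ a b → θ a' b → a ≡ a')

  image : (E → F) → SetOf E → SetOf F
  image f x b = ∃ λ a → x a × f a ≡ b

_∘ᵣ_ : {E F G : Set} → RelOf F G → RelOf E F → RelOf E G
(φ ∘ᵣ θ) a c = ∃ λ b → θ a b × φ b c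

idRel : {E : Set} → SetOf E → RelOf E E
idRel x a b = x a × a ≡ b

mapRel : {E F : Set} → (E → F) → RelOf E E → RelOf F F
mapRel f θ a b = ∃ λ s → ∃ λ s' → θ s s' × f s ≡ a × f s' ≡ b

record ESData : Set₁ where
  field
    Ev  : Set
    _≤_ : Ev → Ev → Set
    _#_ : Ev → Ev → Set

module _ (E : ESData) where
  open ESData E

  record IsEventStructure : Set where
    field
      enc      : Ev → ℕ
      enc-inj  : ∀ {a b} → enc a ≡ enc b → a ≡ b
      ≤-refl    : ∀ a → a ≤ a
      ≤-trans   : ∀ {a b c} → a ≤ b → b ≤ c → a ≤ c
      ≤-antisym : ∀ {a b} → a ≤ b → b ≤ a → a ≡ b
      down-fin  : ∀ e → Finite (λ e' → e' ≤ e)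
      #-irrefl : ∀ a → ¬ (a # a)
      #-sym    : ∀ {a b} → a # b → b # a
      #-her    : ∀ {a b c} → a # b → b ≤ c → a # c

  IsConfig : SetOf Ev → Set
  IsConfig x = Finite x
             × (∀ a b → x b → a ≤ b → x a)
             × (∀ a b → x a → x b → ¬ (a # b))

  _<E_ : Ev → Ev → Set
  a <E b = a ≤ b × ¬ (a ≡ b)

  _⇝_ : Ev → Ev → Set
  a ⇝ b = a <E b × (∀ c → a <E c → c <E b → ⊥)

  Maximal : SetOf Ev → Ev → Set
  Maximal x e = x e × (∀ e' → x e' → e ≤ e' → e' ≡ e)

  record IsIsoFamily (S : RelOf Ev Ev → Set) : Set₁ where
    field
      bij      : ∀ {θ} → S θ → IsBij θ × IsConfig (dom θ) × IsConfig (cod θ)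
      resp     : ∀ {θ θ'} → S θ → θ ≐ᵣ θ' → S θ'
      identity : ∀ {x} → IsConfig x → S (idRel x)
      compose  : ∀ {θ φ} → S θ → S φ → cod θ ≐ₛ dom φ → S (φ ∘ᵣ θ)
      inverse  : ∀ {θ} → S θ → S (inv θ)
      restr    : ∀ {θ x'} → S θ → IsConfig x' → x' ⊆ₛ dom θ → S (restrict θ x')
      ext      : ∀ {θ x} → S θ → IsConfig x → dom θ ⊆ₛ x →
                 Σ (RelOf Ev Ev) λ θ' → S θ' × θ ⊆ᵣ θ' × dom θ' ≐ₛ x

data Pol : Set where
  pos neg : Pol

flipPol : Pol → Pol
flipPol pos = neg
flipPol neg = pos

data Payoff : Set where
  lose draw win : Payoff   -- -1 , 0 , +1

negPay : Payoff → Payoff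
negPay lose = win
negPay draw = draw
negPay win  = lose

_℘_ : Payoff → Payoff → Payoff
win  ℘ v    = win
lose ℘ win  = win
lose ℘ lose = lose
lose ℘ draw = lose
draw ℘ win  = win
draw ℘ lose = lose
draw ℘ draw = draw

NonNeg : Payoff → Set
NonNeg lose = ⊥
NonNeg draw = ⊤
NonNeg win  = ⊤

record RawGame : Set₁ where
  field
    es  : ESData
  open ESData es public
  field
    Sym : RelOf Ev Ev → Set
    pol : Ev → Pol
    κ   : SetOf Ev → Payoff

record Game : Set₁ where
  field
    raw : RawGame
  open RawGame raw public
  field
    isES    : IsEventStructure es
    isIso   : IsIsoFamily es Sym
    pol-pres : ∀ {θ a b} → Sym θ → θ a b → pol a ≡ pol b
    Sym+ Sym- : RelOf Ev Ev → Set
    iso+    : IsIsoFamily es Sym+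
    iso-    : IsIsoFamily es Sym-
    sub+    : ∀ {θ} → Sym+ θ → Sym θ
    sub-    : ∀ {θ} → Sym- θ → Sym θ
    meet    : ∀ {θ} → Sym+ θ → Sym- θ → θ ≐ᵣ idRel (dom θ)
    ext+    : ∀ {θ θ'} → Sym+ θ → Sym θ' → θ ⊆ᵣ θ' →
              (∀ a b → θ' a b → ¬ θ a b → pol a ≡ pos) → Sym+ θ'
    ext-    : ∀ {θ θ'} → Sym- θ → Sym θ' → θ ⊆ᵣ θ' →
              (∀ a b → θ' a b → ¬ θ a b → pol a ≡ neg) → Sym- θ'
    -- payoff on configurations (sets taken extensionally), symmetry-invariant
    κ-resp  : ∀ {x y} → IsConfig es x → x ≐ₛ y → κ x ≡ κ y
    κ-inv   : ∀ {θ} → Sym θ → κ (dom θ) ≡ κ (cod θ)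
    canon   : SetOf Ev → SetOf Ev
    canon-conf : ∀ {x} → IsConfig es x → κ x ≡ draw → IsConfig es (canon x)
    canon-sym  : ∀ {x} → IsConfig es x → κ x ≡ draw →
                 Σ (RelOf Ev Ev) λ θ → Sym θ × dom θ ≐ₛ x × cod θ ≐ₛ canon x
    canon-inv  : ∀ {θ} → Sym θ → κ (dom θ) ≡ draw → canon (dom θ) ≐ₛ canon (cod θ)

_∥_ : {E F : Set} → SetOf E → SetOf F → SetOf (E ⊎ F)
(x ∥ y) (inj₁ a) = x a
(x ∥ y) (inj₂ b) = y b

module _ (A B : Game) where
  private
    module A = Game A
    module B = Game B
    E = A.Ev ⊎ B.Ev

  ≤⊢ : E → E → Set
  ≤⊢ (inj₁ a) (inj₁ a') = A._≤_ a a'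
  ≤⊢ (inj₂ b) (inj₂ b') = B._≤_ b b'
  ≤⊢ _ _ = ⊥

  #⊢ : E → E → Set
  #⊢ (inj₁ a) (inj₁ a') = A._#_ a a'
  #⊢ (inj₂ b) (inj₂ b') = B._#_ b b'
  #⊢ _ _ = ⊥

  Sym⊢ : RelOf E E → Set
  Sym⊢ θ = A.Sym (λ a a' → θ (inj₁ a) (inj₁ a'))
         × B.Sym (λ b b' → θ (inj₂ b) (inj₂ b'))
         × (∀ a b → ¬ θ (inj₁ a) (inj₂ b))
         × (∀ a b → ¬ θ (inj₂ b) (inj₁ a))

  pol⊢ : E → Pol
  pol⊢ (inj₁ a) = flipPol (A.pol a)
  pol⊢ (inj₂ b) = B.pol b

  κ⊢ : SetOf E → Payoff
  κ⊢ x = negPay (A.κ (λ a → x (inj₁ a))) ℘ B.κ (λ b → x (inj₂ b))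

  _⊢_ : RawGame
  _⊢_ = record
    { es  = record { Ev = E ; _≤_ = ≤⊢ ; _#_ = #⊢ }
    ; Sym = Sym⊢ ; pol = pol⊢ ; κ = κ⊢ }

record Strategy (G : RawGame) : Set₁ where
  private module G = RawGame G
  field
    σ    : ESData
  open ESData σ public
  field
    isES  : IsEventStructure σ
    Symσ  : RelOf Ev Ev → Set
    isIso : IsIsoFamily σ Symσ
    ∂     : Ev → G.Ev
  polσ : Ev → Pol
  polσ s = G.pol (∂ s)
  field
    ∂-conf : ∀ {x} → IsConfig σ x → IsConfig G.es (image ∂ x)
    ∂-inj  : ∀ {x} → IsConfig σ x → ∀ s s' → x s → x s' → ∂ s ≡ ∂ s' → s ≡ s'
    ∂-sym  : ∀ {θ} → Symσ θ → G.Sym (mapRel ∂ θ)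
    ~-receptive : ∀ {θ s₁ a₂} → Symσ θ → IsConfig σ (insert (dom θ) s₁) →
                  ¬ dom θ s₁ → polσ s₁ ≡ neg →
                  G.Sym (extendR (mapRel ∂ θ) (∂ s₁) a₂) →
                  ∃! (λ s₂ → Symσ (extendR θ s₁ s₂) × ∂ s₂ ≡ a₂)
    thin : ∀ {θ s₁} → Symσ θ → IsConfig σ (insert (dom θ) s₁) →
           ¬ dom θ s₁ → polσ s₁ ≡ pos →
           ∃! (λ s₂ → IsConfig σ (insert (cod θ) s₂) × Symσ (extendR θ s₁ s₂))
    min-neg : ∀ s → (∀ s' → s' ≤ s → s' ≡ s) → polσ s ≡ neg
    courteous : ∀ {s₁ s₂} → _⇝_ σ s₁ s₂ → (polσ s₁ ≡ pos ⊎ polσ s₂ ≡ neg) →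
                _⇝_ G.es (∂ s₁) (∂ s₂)
    receptive : ∀ {x a} → IsConfig σ x → G.pol a ≡ neg → ¬ image ∂ x a →
                IsConfig G.es (insert (image ∂ x) a) →
                ∃! (λ s → IsConfig σ (insert x s) × ∂ s ≡ a)

  PlusCovered : SetOf Ev → Set
  PlusCovered x = IsConfig σ x × (∀ s → Maximal σ x s → polσ s ≡ pos)

  Exhaustive : Set₁
  Exhaustive = ∀ x → PlusCovered x → NonNeg (G.κ (image ∂ x))

-- By exhaustivity each +-covered configuration wins or draws in its own game.
-- Since the A- and C-components draw, the payoff of σ's play is κ_B(x_B) and that of τ's
-- play is the negation of κ_B(x_B); both are ≥ 0, which forces κ_B(x_B) = 0.
module Submission where

open import Defs
open import Relation.Binary.PropositionalEquality using (_≡_; refl; cong₂)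
open import Data.Product using (_,_; proj₁; proj₂)
open import Data.Sum using (inj₁; inj₂; isInj₁; isInj₂)
open import Data.Maybe using (Maybe; just; nothing)
import Data.Maybe.Relation.Unary.Any as MaybeAny
open import Data.List using ([]; _∷_; mapMaybe)
open import Data.List.Membership.Propositional using (_∈_)
open import Data.List.Relation.Unary.Any as Any using (here; there)
import Data.List.Relation.Unary.Any.Properties as AnyProp

module _ {E F : Set} (f : E → F) (g : F → Maybe E)
         (g∘f : ∀ e → g (f e) ≡ just e) (g-just : ∀ {y e} → g y ≡ just e → f e ≡ y) where

  ∈-mapMaybe⁺ : ∀ {e} l → f e ∈ l → e ∈ mapMaybe g l
  ∈-mapMaybe⁺ {e} l fe∈l = AnyProp.mapMaybe⁺ g l (AnyProp.map⁺ (Any.map found fe∈l))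
    where
    found : ∀ {y} → f e ≡ y → MaybeAny.Any (e ≡_) (g y)
    found refl rewrite g∘f e = MaybeAny.just refl

  ∈-mapMaybe⁻ : ∀ {e} l → e ∈ mapMaybe g l → f e ∈ l
  ∈-mapMaybe⁻ [] ()
  ∈-mapMaybe⁻ (y ∷ l) e∈ with g y in gy
  ... | nothing = there (∈-mapMaybe⁻ l e∈)
  ... | just _ with e∈
  ...   | here refl = here (g-just gy)
  ...   | there e∈l = there (∈-mapMaybe⁻ l e∈l)

  Finite-preimage : {x : SetOf F} → Finite x → Finite (λ e → x (f e))
  Finite-preimage (l , enum) =
    mapMaybe g l , λ e → (λ xfe → ∈-mapMaybe⁺ l (proj₁ (enum (f e)) xfe))
                       , (λ e∈ → proj₂ (enum (f e)) (∈-mapMaybe⁻ l e∈))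

module _ (A B : Game) where
  private
    module A = Game A
    module B = Game B
    A⊢B = RawGame.es (A ⊢ B)

  IsConfig-⊢ˡ : ∀ {x} → IsConfig A⊢B x → IsConfig A.es (λ a → x (inj₁ a))
  IsConfig-⊢ˡ (fin , down , free) =
    Finite-preimage inj₁ isInj₁ (λ _ → refl) (λ { {inj₁ _} refl → refl }) fin
    , (λ a a' → down (inj₁ a) (inj₁ a'))
    , (λ a a' → free (inj₁ a) (inj₁ a'))

  IsConfig-⊢ʳ : ∀ {x} → IsConfig A⊢B x → IsConfig B.es (λ b → x (inj₂ b))
  IsConfig-⊢ʳ (fin , down , free) =
    Finite-preimage inj₂ isInj₂ (λ _ → refl) (λ { {inj₂ _} refl → refl }) fin
    , (λ b b' → down (inj₂ b) (inj₂ b'))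
    , (λ b b' → free (inj₂ b) (inj₂ b'))

  κ⊢-∥ : ∀ {x xA xB} → IsConfig A⊢B x → x ≐ₛ (xA ∥ xB) →
         κ⊢ A B x ≡ negPay (A.κ xA) ℘ B.κ xB
  κ⊢-∥ cx (x⊆ , ⊇x) =
    cong₂ (λ u v → negPay u ℘ v)
      (A.κ-resp (IsConfig-⊢ˡ cx) ((λ a → x⊆ (inj₁ a)) , (λ a → ⊇x (inj₁ a))))
      (B.κ-resp (IsConfig-⊢ʳ cx) ((λ b → x⊆ (inj₂ b)) , (λ b → ⊇x (inj₂ b))))

  Exhaustive-∥ : (σ : Strategy (A ⊢ B)) → Strategy.Exhaustive σ →
                 ∀ {x xA xB} → Strategy.PlusCovered σ x →
                 image (Strategy.∂ σ) x ≐ₛ (xA ∥ xB) →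
                 NonNeg (negPay (A.κ xA) ℘ B.κ xB)
  Exhaustive-∥ σ exhaustive {x} covered ∂x≐ with exhaustive x covered
  ... | nonneg rewrite κ⊢-∥ (Strategy.∂-conf σ (proj₁ covered)) ∂x≐ = nonneg

draw-of-nonneg-both-sides : ∀ p → NonNeg (negPay draw ℘ p) → NonNeg (negPay p ℘ draw) → p ≡ draw
draw-of-nonneg-both-sides draw _ _ = refl

lemma4p2 : (A B C : Game) →
    (σ : Strategy (A ⊢ B)) → (τ : Strategy (B ⊢ C)) →
    Strategy.Exhaustive σ → Strategy.Exhaustive τ →
    (xσ : SetOf (Strategy.Ev σ)) → (xτ : SetOf (Strategy.Ev τ)) →
    Strategy.PlusCovered σ xσ → Strategy.PlusCovered τ xτ →
    (xA : SetOf (Game.Ev A)) → (xB : SetOf (Game.Ev B)) → (xC : SetOf (Game.Ev C)) →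
    IsConfig (Game.es B) xB →
    image (Strategy.∂ σ) xσ ≐ₛ (xA ∥ xB) →
    image (Strategy.∂ τ) xτ ≐ₛ (xB ∥ xC) →
    Game.κ A xA ≡ draw → Game.κ C xC ≡ draw →
    Game.κ B xB ≡ draw
lemma4p2 A B C σ τ exσ exτ xσ xτ coveredσ coveredτ xA xB xC _ ∂xσ≐ ∂xτ≐ κA≡draw κC≡draw
  with Exhaustive-∥ A B σ exσ coveredσ ∂xσ≐ | Exhaustive-∥ B C τ exτ coveredτ ∂xτ≐
... | σ-nonneg | τ-nonneg rewrite κA≡draw | κC≡draw =
  draw-of-nonneg-both-sides (Game.κ B xB) σ-nonneg τ-nonneg
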